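{- Each of $S_n(123, 213)$, $S_n(321, 231)$, $S_n(123, 132)$ and $S_n(321, 312)$ is sign-balanced for every integer $n>1$.
   Context: For $\sigma\in S_k$, $\pi\in S_n$ (one-line notation), $k\le n$, $\pi$ contains $\sigma$ if there are indices $i_1<\cdots<i_k$ with $\pi_{i_s}>\pi_{i_t}$ iff $\sigma_s>\sigma_t$ for all $s<t$; otherwise $\pi$ avoids $\sigma$. $S_n(\sigma_1,\ldots,\sigma_r)$ is the set of permutations in $S_n$ avoiding every $\sigma_j$. A permutation is even (odd) if its number of inversions (pairs $i<j$ with $\pi_i>\pi_j$) is even (odd). A set of permutations is sign-balanced if it contains equally many even and odd permutations. -}

module Defs where

open import Data.Nat using (ℕ; zero; suc; _+_; _<ᵇ_; _≡ᵇ_)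
open import Data.Nat.Properties using ()
open import Data.Bool using (Bool; true; false; _∧_; _∨_; not; if_then_else_)
open import Data.Fin using (Fin; toℕ)
open import Data.Fin.Properties using ()
open import Data.List using (List; []; _∷_; map; length; filterᵇ; concatMap; allFin)
open import Data.Vec using (Vec; toList)

anyᵇ : {A : Set} → (A → Bool) → List A → Bool
anyᵇ p [] = false
anyᵇ p (x ∷ xs) = p x ∨ anyᵇ p xs

allᵇ : {A : Set} → (A → Bool) → List A → Bool
allᵇ p [] = true
allᵇ p (x ∷ xs) = p x ∧ allᵇ p xs
import Data.Vec as V

-- Permutations of [n] in one-line notation are represented as vectors
-- (π₁, …, πₙ) of elements of Fin n with pairwise distinct entries.
-- Patterns σ ∈ S_k are given as lists of natural numbers in one-line notation.

_>ᵇ_ : ℕ → ℕ → Bool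
a >ᵇ b = b <ᵇ a

_⇔ᵇ_ : Bool → Bool → Bool
true  ⇔ᵇ b = b
false ⇔ᵇ b = not b

subseqs : {A : Set} → List A → List (List A)
subseqs [] = [] ∷ []
subseqs (x ∷ xs) = map (x ∷_) (subseqs xs) Data.List.++ subseqs xs

headAgrees : ℕ → ℕ → List ℕ → List ℕ → Bool
headAgrees a b (x ∷ xs) (y ∷ ys) = ((a >ᵇ x) ⇔ᵇ (b >ᵇ y)) ∧ headAgrees a b xs ys
headAgrees a b _ _ = true

-- two sequences of equal length are order-isomorphic:
-- for all s < t,  u_s > u_t  iff  w_s > w_t
orderIso : List ℕ → List ℕ → Bool
orderIso [] [] = true
orderIso (a ∷ as) (b ∷ bs) = headAgrees a b as bs ∧ orderIso as bs
orderIso _ _ = false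

-- π contains σ: some subsequence of π of length k is order-isomorphic to σ
-- (orderIso already forces the lengths to agree)
containsᵇ : List ℕ → List ℕ → Bool
containsᵇ π σ = anyᵇ (λ u → orderIso u σ) (subseqs π)

avoidsAllᵇ : List ℕ → List (List ℕ) → Bool
avoidsAllᵇ π σs = allᵇ (λ σ → not (containsᵇ π σ)) σs

inversions : List ℕ → ℕ
inversions [] = 0
inversions (x ∷ xs) = length (filterᵇ (λ y → x >ᵇ y) xs) + inversions xs

isEvenᵇ : ℕ → Bool
isEvenᵇ zero = true
isEvenᵇ (suc m) = not (isEvenᵇ m)

distinctᵇ : List ℕ → Bool
distinctᵇ [] = true
distinctᵇ (x ∷ xs) = allᵇ (λ y → not (x ≡ᵇ y)) xs ∧ distinctᵇ xs

allVecs : (n k : ℕ) → List (Vec (Fin n) k)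
allVecs n zero = V.[] ∷ []
allVecs n (suc k) = concatMap (λ i → map (i V.∷_) (allVecs n k)) (allFin n)

oneLine : {n : ℕ} → Vec (Fin n) n → List ℕ
oneLine v = map toℕ (toList v)

Sym : (n : ℕ) → List (Vec (Fin n) n)
Sym n = filterᵇ (λ v → distinctᵇ (oneLine v)) (allVecs n n)

Av : (n : ℕ) → List (List ℕ) → List (Vec (Fin n) n)
Av n σs = filterᵇ (λ v → avoidsAllᵇ (oneLine v) σs) (Sym n)

#even : {n : ℕ} → List (Vec (Fin n) n) → ℕ
#even ps = length (filterᵇ (λ v → isEvenᵇ (inversions (oneLine v))) ps)

#odd : {n : ℕ} → List (Vec (Fin n) n) → ℕ
#odd ps = length (filterᵇ (λ v → not (isEvenᵇ (inversions (oneLine v)))) ps)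

open import Relation.Binary.PropositionalEquality using (_≡_)

SignBalanced : {n : ℕ} → List (Vec (Fin n) n) → Set
SignBalanced ps = #even ps ≡ #odd ps

{-# OPTIONS --safe #-}
-- Exchanging two adjacent entries of a permutation changes its number of
-- inversions by exactly one.  Exchanging the first two entries maps an
-- occurrence of a pattern that uses both of them to an occurrence of the
-- pattern with its first two letters exchanged, and leaves every other
-- occurrence alone; the same holds for the last two entries.  So for
-- σ ∈ {123, 321} the exchange of the first two entries is a sign-reversing
-- involution on S_n(σ, σ with its first two letters exchanged), and the
-- exchange of the last two entries is one on S_n(σ, σ with its last two
-- letters exchanged).

module Submission where

open import Defs
open import Algebra.Bundles using (CommutativeMonoid)
open import Data.Bool using (Bool; true; false; T; _∧_; _∨_; not)
open import Data.Bool.Properties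
  using (∧-commutativeMonoid; ∨-commutativeMonoid; ∨-comm; ∨-assoc; ∧-identityʳ; ∧-zeroʳ;
         not-involutive; T-∧; T-not-≡)
open import Data.Fin using (Fin; toℕ)
open import Data.List using (List; []; _∷_; _++_; map; length; filterᵇ; concatMap; allFin)
open import Data.List.Properties using (map-cong; length-++)
open import Data.Nat using (ℕ; zero; suc; _+_; _<_; _<ᵇ_; _≡ᵇ_; s≤s)
open import Data.Nat.ListAction using (sum)
open import Data.Nat.Properties
  using (+-assoc; +-commutativeSemigroup; +-cancelʳ-≡; suc-injective; ≡⇒≡ᵇ; _≟_)
open import Data.Product using (_×_; _,_; proj₁; proj₂)
open import Data.Vec using (Vec; []; _∷_; toList)
open import Function using (_∘_; id; Equivalence)
open import Relation.Binary.PropositionalEquality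
open import Relation.Nullary using (yes; no; contradiction)

open import Algebra.Properties.CommutativeSemigroup +-commutativeSemigroup
  using () renaming (interchange to +-interchange; x∙yz≈y∙xz to +-leftComm)
open import Algebra.Properties.CommutativeSemigroup
    (CommutativeMonoid.commutativeSemigroup ∧-commutativeMonoid)
  using () renaming (interchange to ∧-interchange; x∙yz≈y∙xz to ∧-leftComm)
open import Algebra.Properties.CommutativeSemigroup
    (CommutativeMonoid.commutativeSemigroup ∨-commutativeMonoid)
  using () renaming (interchange to ∨-interchange)

open ≡-Reasoning

private
  variable
    A B : Set

fromBool : Bool → ℕ
fromBool true  = 1
fromBool false = 0

count : (A → Bool) → List A → ℕ
count p xs = length (filterᵇ p xs)

count-∷ : (p : A → Bool) (x : A) (xs : List A) → count p (x ∷ xs) ≡ fromBool (p x) + count p xs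
count-∷ p x xs with p x
... | true  = refl
... | false = refl

count-++ : (p : A → Bool) (xs ys : List A) → count p (xs ++ ys) ≡ count p xs + count p ys
count-++ p []       ys = refl
count-++ p (x ∷ xs) ys with p x
... | true  = cong suc (count-++ p xs ys)
... | false = count-++ p xs ys

count-map : (p : B → Bool) (f : A → B) (xs : List A) → count p (map f xs) ≡ count (p ∘ f) xs
count-map p f []       = refl
count-map p f (x ∷ xs) with p (f x)
... | true  = cong suc (count-map p f xs)
... | false = count-map p f xs

count-cong : {p q : A → Bool} → (∀ x → p x ≡ q x) → (xs : List A) → count p xs ≡ count q xs
count-cong p≗q []       = refl
count-cong {p = p} {q} p≗q (x ∷ xs) = begin
  count p (x ∷ xs)               ≡⟨ count-∷ p x xs ⟩
  fromBool (p x) + count p xs    ≡⟨ cong₂ (λ b n → fromBool b + n) (p≗q x) (count-cong p≗q xs) ⟩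
  fromBool (q x) + count q xs    ≡⟨ count-∷ q x xs ⟨
  count q (x ∷ xs)               ∎

count-filterᵇ : (p q : A → Bool) (xs : List A) → count p (filterᵇ q xs) ≡ count (λ x → q x ∧ p x) xs
count-filterᵇ p q []       = refl
count-filterᵇ p q (x ∷ xs) with q x
... | false = count-filterᵇ p q xs
... | true with p x
...   | true  = cong suc (count-filterᵇ p q xs)
...   | false = count-filterᵇ p q xs

sum-map-zero : (xs : List A) → sum (map (λ _ → 0) xs) ≡ 0
sum-map-zero []       = refl
sum-map-zero (x ∷ xs) = sum-map-zero xs

sum-map-+ : (f g : A → ℕ) (xs : List A) →
            sum (map (λ x → f x + g x) xs) ≡ sum (map f xs) + sum (map g xs)
sum-map-+ f g []       = refl
sum-map-+ f g (x ∷ xs) = trans (cong (f x + g x +_) (sum-map-+ f g xs))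
                               (+-interchange (f x) (g x) _ _)

sum-map-comm : (g : A → B → ℕ) (xs : List A) (ys : List B) →
               sum (map (λ x → sum (map (g x) ys)) xs) ≡ sum (map (λ y → sum (map (λ x → g x y) xs)) ys)
sum-map-comm g []       ys = sym (sum-map-zero ys)
sum-map-comm g (x ∷ xs) ys = trans (cong (sum (map (g x) ys) +_) (sum-map-comm g xs ys))
                                   (sym (sum-map-+ (g x) (λ y → sum (map (λ x → g x y) xs)) ys))

count-concatMap : (p : B → Bool) (f : A → List B) (xs : List A) →
                  count p (concatMap f xs) ≡ sum (map (count p ∘ f) xs)
count-concatMap p f []       = refl
count-concatMap p f (x ∷ xs) =
  trans (count-++ p (f x) _) (cong (count p (f x) +_) (count-concatMap p f xs))

count-allVecs-∷ : ∀ {n k} (P : Vec (Fin n) (suc k) → Bool) →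
                  count P (allVecs n (suc k)) ≡ sum (map (λ i → count (λ w → P (i ∷ w)) (allVecs n k)) (allFin n))
count-allVecs-∷ {n} {k} P =
  trans (count-concatMap P (λ i → map (i ∷_) (allVecs n k)) (allFin n))
        (cong sum (map-cong (λ i → count-map P (i ∷_) (allVecs n k)) (allFin n)))

swapFront : ∀ {k} → Vec A (2 + k) → Vec A (2 + k)
swapFront (a ∷ b ∷ w) = b ∷ a ∷ w

swapBack : ∀ {k} → Vec A (2 + k) → Vec A (2 + k)
swapBack {k = zero}  (a ∷ b ∷ []) = b ∷ a ∷ []
swapBack {k = suc k} (a ∷ w)      = a ∷ swapBack w

count-allVecs-swapFront : ∀ n k (P : Vec (Fin n) (2 + k) → Bool) →
                          count P (allVecs n (2 + k)) ≡ count (P ∘ swapFront) (allVecs n (2 + k))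
count-allVecs-swapFront n k P = begin
  count P (allVecs n (2 + k))                        ≡⟨ expand P ⟩
  sum (map (λ i → sum (map (λ j → g i j) F)) F)      ≡⟨ sum-map-comm g F F ⟩
  sum (map (λ j → sum (map (λ i → g i j) F)) F)      ≡⟨ expand (P ∘ swapFront) ⟨
  count (P ∘ swapFront) (allVecs n (2 + k))          ∎
  where
  F = allFin n
  g : Fin n → Fin n → ℕ
  g i j = count (λ w → P (i ∷ j ∷ w)) (allVecs n k)
  expand : (Q : Vec (Fin n) (2 + k) → Bool) →
           count Q (allVecs n (2 + k)) ≡ sum (map (λ i → sum (map (λ j → count (λ w → Q (i ∷ j ∷ w)) (allVecs n k)) F)) F)
  expand Q = trans (count-allVecs-∷ Q) (cong sum (map-cong (λ i → count-allVecs-∷ (λ w → Q (i ∷ w))) F))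

count-allVecs-swapBack : ∀ n k (P : Vec (Fin n) (2 + k) → Bool) →
                         count P (allVecs n (2 + k)) ≡ count (P ∘ swapBack) (allVecs n (2 + k))
count-allVecs-swapBack n zero P =
  trans (count-allVecs-swapFront n 0 P) (count-cong (λ { (a ∷ b ∷ []) → refl }) (allVecs n 2))
count-allVecs-swapBack n (suc k) P = begin
  count P (allVecs n (3 + k))                                               ≡⟨ count-allVecs-∷ P ⟩
  sum (map (λ i → count (λ w → P (i ∷ w)) (allVecs n (2 + k))) (allFin n))  ≡⟨ cong sum (map-cong ih (allFin n)) ⟩
  sum (map (λ i → count (λ w → P (i ∷ swapBack w)) (allVecs n (2 + k))) (allFin n))
                                                                            ≡⟨ count-allVecs-∷ (P ∘ swapBack) ⟨
  count (P ∘ swapBack) (allVecs n (3 + k))                                  ∎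
  where
  ih : ∀ i → count (λ w → P (i ∷ w)) (allVecs n (2 + k)) ≡ count (λ w → P (i ∷ swapBack w)) (allVecs n (2 + k))
  ih i = count-allVecs-swapBack n k (λ w → P (i ∷ w))

Even : List ℕ → Bool
Even l = isEvenᵇ (inversions l)

record SignReversal (σs : List (List ℕ)) (l l′ : List ℕ) : Set where
  field
    distinct-eq : distinctᵇ l′ ≡ distinctᵇ l
    avoids-eq   : T (distinctᵇ l) → avoidsAllᵇ l′ σs ≡ avoidsAllᵇ l σs
    sign-flip   : T (distinctᵇ l) → Even l′ ≡ not (Even l)

SignReversal-even⇒odd : ∀ {σs l l′} → SignReversal σs l l′ →
  distinctᵇ l′ ∧ (avoidsAllᵇ l′ σs ∧ Even l′) ≡ distinctᵇ l ∧ (avoidsAllᵇ l σs ∧ not (Even l))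
SignReversal-even⇒odd {l = l} r = select (distinctᵇ l) _ _ _ _ _ distinct-eq avoids-eq sign-flip
  where
  open SignReversal r
  select : (d d′ α α′ ε ε′ : Bool) → d′ ≡ d → (T d → α′ ≡ α) → (T d → ε′ ≡ not ε) →
           d′ ∧ (α′ ∧ ε′) ≡ d ∧ (α ∧ not ε)
  select false _ _ _ _ _ refl _   _   = refl
  select true  _ _ _ _ _ refl α≡ ε≡ = cong₂ _∧_ (α≡ _) (ε≡ _)

signBalanced-bySignReversal :
  ∀ {n} σs (s : Vec (Fin n) n → Vec (Fin n) n) →
  (∀ P → count P (allVecs n n) ≡ count (P ∘ s) (allVecs n n)) →
  (∀ v → SignReversal σs (oneLine v) (oneLine (s v))) →
  SignBalanced (Av n σs)
signBalanced-bySignReversal {n} σs s s-permutes s-reverses = begin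
  count E (filterᵇ Av? (filterᵇ D all))       ≡⟨ selected E ⟩
  count (λ v → D v ∧ (Av? v ∧ E v)) all       ≡⟨ s-permutes _ ⟩
  count (λ v → D (s v) ∧ (Av? (s v) ∧ E (s v))) all
                                              ≡⟨ count-cong (SignReversal-even⇒odd ∘ s-reverses) all ⟩
  count (λ v → D v ∧ (Av? v ∧ not (E v))) all ≡⟨ selected (not ∘ E) ⟨
  count (not ∘ E) (filterᵇ Av? (filterᵇ D all)) ∎
  where
  all = allVecs n n
  D Av? E : Vec (Fin n) n → Bool
  D v   = distinctᵇ (oneLine v)
  Av? v = avoidsAllᵇ (oneLine v) σs
  E v   = Even (oneLine v)
  selected : (Q : Vec (Fin n) n → Bool) →
             count Q (filterᵇ Av? (filterᵇ D all)) ≡ count (λ v → D v ∧ (Av? v ∧ Q v)) all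
  selected Q = trans (count-filterᵇ Q Av? (filterᵇ D all)) (count-filterᵇ (λ v → Av? v ∧ Q v) D all)

<ᵇ-flip : ∀ {a b} → a ≢ b → (b <ᵇ a) ≡ not (a <ᵇ b)
<ᵇ-flip {zero}  {zero}  a≢b = contradiction refl a≢b
<ᵇ-flip {zero}  {suc b} _   = refl
<ᵇ-flip {suc a} {zero}  _   = refl
<ᵇ-flip {suc a} {suc b} a≢b = <ᵇ-flip (a≢b ∘ cong suc)

≡ᵇ-comm : ∀ a b → (a ≡ᵇ b) ≡ (b ≡ᵇ a)
≡ᵇ-comm zero    zero    = refl
≡ᵇ-comm zero    (suc b) = refl
≡ᵇ-comm (suc a) zero    = refl
≡ᵇ-comm (suc a) (suc b) = ≡ᵇ-comm a b

count-swap : (p : ℕ → Bool) (q : List ℕ) (a b : ℕ) (r : List ℕ) →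
             count p (q ++ b ∷ a ∷ r) ≡ count p (q ++ a ∷ b ∷ r)
count-swap p [] a b r = begin
  count p (b ∷ a ∷ r)                           ≡⟨ count-∷∷ b a ⟩
  fromBool (p b) + (fromBool (p a) + count p r) ≡⟨ +-leftComm (fromBool (p b)) (fromBool (p a)) (count p r) ⟩
  fromBool (p a) + (fromBool (p b) + count p r) ≡⟨ count-∷∷ a b ⟨
  count p (a ∷ b ∷ r)                           ∎
  where
  count-∷∷ : ∀ x y → count p (x ∷ y ∷ r) ≡ fromBool (p x) + (fromBool (p y) + count p r)
  count-∷∷ x y = trans (count-∷ p x (y ∷ r)) (cong (fromBool (p x) +_) (count-∷ p y r))
count-swap p (x ∷ q) a b r with p x
... | true  = cong suc (count-swap p q a b r)
... | false = count-swap p q a b r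

allᵇ-swap : (p : ℕ → Bool) (q : List ℕ) (a b : ℕ) (r : List ℕ) →
            allᵇ p (q ++ b ∷ a ∷ r) ≡ allᵇ p (q ++ a ∷ b ∷ r)
allᵇ-swap p []      a b r = ∧-leftComm (p b) (p a) (allᵇ p r)
allᵇ-swap p (x ∷ q) a b r = cong (p x ∧_) (allᵇ-swap p q a b r)

distinctᵇ-swap : (q : List ℕ) (a b : ℕ) (r : List ℕ) →
                 distinctᵇ (q ++ b ∷ a ∷ r) ≡ distinctᵇ (q ++ a ∷ b ∷ r)
distinctᵇ-swap [] a b r = begin
  (not (b ≡ᵇ a) ∧ all≢ b) ∧ (all≢ a ∧ distinctᵇ r) ≡⟨ ∧-interchange (not (b ≡ᵇ a)) (all≢ b) (all≢ a) (distinctᵇ r) ⟩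
  (not (b ≡ᵇ a) ∧ all≢ a) ∧ (all≢ b ∧ distinctᵇ r) ≡⟨ cong (λ e → (not e ∧ all≢ a) ∧ (all≢ b ∧ distinctᵇ r)) (≡ᵇ-comm b a) ⟩
  (not (a ≡ᵇ b) ∧ all≢ a) ∧ (all≢ b ∧ distinctᵇ r) ∎
  where
  all≢ : ℕ → Bool
  all≢ x = allᵇ (λ y → not (x ≡ᵇ y)) r
distinctᵇ-swap (x ∷ q) a b r =
  cong₂ _∧_ (allᵇ-swap (λ y → not (x ≡ᵇ y)) q a b r) (distinctᵇ-swap q a b r)

distinctᵇ⇒≢ : (q : List ℕ) {a b : ℕ} {r : List ℕ} → T (distinctᵇ (q ++ a ∷ b ∷ r)) → a ≢ b
distinctᵇ⇒≢ []      {a} d refl =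
  subst T (Equivalence.to T-not-≡ (proj₁ (Equivalence.to T-∧ (proj₁ (Equivalence.to T-∧ d))))) (≡⇒≡ᵇ a a refl)
distinctᵇ⇒≢ (x ∷ q) d = distinctᵇ⇒≢ q (proj₂ (Equivalence.to T-∧ d))

inversions-∷∷ : (a b : ℕ) (r : List ℕ) → inversions (a ∷ b ∷ r) ≡
  fromBool (b <ᵇ a) + (count (a >ᵇ_) r + (count (b >ᵇ_) r + inversions r))
inversions-∷∷ a b r = trans (cong (_+ (count (b >ᵇ_) r + inversions r)) (count-∷ (a >ᵇ_) b r))
                            (+-assoc (fromBool (b <ᵇ a)) _ _)

isEvenᵇ-fromBool : (t : Bool) (m : ℕ) → isEvenᵇ (fromBool t + m) ≡ not (isEvenᵇ (fromBool (not t) + m))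
isEvenᵇ-fromBool true  m = refl
isEvenᵇ-fromBool false m = sym (not-involutive (isEvenᵇ m))

isEvenᵇ-+-flip : (c : ℕ) {m m′ : ℕ} → isEvenᵇ m ≡ not (isEvenᵇ m′) → isEvenᵇ (c + m) ≡ not (isEvenᵇ (c + m′))
isEvenᵇ-+-flip zero    m≡ = m≡
isEvenᵇ-+-flip (suc c) m≡ = cong not (isEvenᵇ-+-flip c m≡)

Even-swap : (q : List ℕ) {a b : ℕ} (r : List ℕ) → a ≢ b → Even (q ++ b ∷ a ∷ r) ≡ not (Even (q ++ a ∷ b ∷ r))
Even-swap [] {a} {b} r a≢b = begin
  isEvenᵇ (inversions (b ∷ a ∷ r))                    ≡⟨ cong isEvenᵇ (inversions-∷∷ b a r) ⟩
  isEvenᵇ (fromBool (a <ᵇ b) + (Cb + (Ca + I)))       ≡⟨ cong (λ m → isEvenᵇ (fromBool (a <ᵇ b) + m)) (+-leftComm Cb Ca I) ⟩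
  isEvenᵇ (fromBool (a <ᵇ b) + N)                     ≡⟨ isEvenᵇ-fromBool (a <ᵇ b) N ⟩
  not (isEvenᵇ (fromBool (not (a <ᵇ b)) + N))         ≡⟨ cong (λ t → not (isEvenᵇ (fromBool t + N))) (<ᵇ-flip a≢b) ⟨
  not (isEvenᵇ (fromBool (b <ᵇ a) + N))               ≡⟨ cong (not ∘ isEvenᵇ) (inversions-∷∷ a b r) ⟨
  not (isEvenᵇ (inversions (a ∷ b ∷ r)))              ∎
  where
  Ca = count (a >ᵇ_) r
  Cb = count (b >ᵇ_) r
  I  = inversions r
  N  = Ca + (Cb + I)
Even-swap (x ∷ q) r a≢b = trans
  (cong (λ c → isEvenᵇ (c + inversions (q ++ _ ∷ _ ∷ r))) (count-swap (x >ᵇ_) q _ _ r))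
  (isEvenᵇ-+-flip (count (x >ᵇ_) (q ++ _ ∷ _ ∷ r)) (Even-swap q r a≢b))

adjacentSwap-reverses : ∀ σs (q : List ℕ) (a b : ℕ) (r : List ℕ) →
  (a ≢ b → avoidsAllᵇ (q ++ b ∷ a ∷ r) σs ≡ avoidsAllᵇ (q ++ a ∷ b ∷ r) σs) →
  SignReversal σs (q ++ a ∷ b ∷ r) (q ++ b ∷ a ∷ r)
adjacentSwap-reverses σs q a b r avoids-swap = record
  { distinct-eq = distinctᵇ-swap q a b r
  ; avoids-eq   = avoids-swap ∘ distinctᵇ⇒≢ q
  ; sign-flip   = Even-swap q r ∘ distinctᵇ⇒≢ q
  }

anyᵇ-++ : (f : A → Bool) (xs ys : List A) → anyᵇ f (xs ++ ys) ≡ anyᵇ f xs ∨ anyᵇ f ys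
anyᵇ-++ f []       ys = refl
anyᵇ-++ f (x ∷ xs) ys = trans (cong (f x ∨_) (anyᵇ-++ f xs ys)) (sym (∨-assoc (f x) _ _))

anyᵇ-map : (f : B → Bool) (g : A → B) (xs : List A) → anyᵇ f (map g xs) ≡ anyᵇ (f ∘ g) xs
anyᵇ-map f g []       = refl
anyᵇ-map f g (x ∷ xs) = cong (f (g x) ∨_) (anyᵇ-map f g xs)

anyᵇ-cong : {f g : A → Bool} → (∀ x → f x ≡ g x) → (xs : List A) → anyᵇ f xs ≡ anyᵇ g xs
anyᵇ-cong f≗g []       = refl
anyᵇ-cong f≗g (x ∷ xs) = cong₂ _∨_ (f≗g x) (anyᵇ-cong f≗g xs)

anyᵇ-∨ : (f g : A → Bool) (xs : List A) → anyᵇ (λ x → f x ∨ g x) xs ≡ anyᵇ f xs ∨ anyᵇ g xs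
anyᵇ-∨ f g []       = refl
anyᵇ-∨ f g (x ∷ xs) = trans (cong ((f x ∨ g x) ∨_) (anyᵇ-∨ f g xs)) (∨-interchange (f x) (g x) _ _)

anyᵇ-subseqs-∷ : (f : List ℕ → Bool) (x : ℕ) (l : List ℕ) →
                 anyᵇ f (subseqs (x ∷ l)) ≡ anyᵇ (f ∘ (x ∷_)) (subseqs l) ∨ anyᵇ f (subseqs l)
anyᵇ-subseqs-∷ f x l =
  trans (anyᵇ-++ f (map (x ∷_) (subseqs l)) (subseqs l)) (cong (_∨ anyᵇ f (subseqs l)) (anyᵇ-map f (x ∷_) (subseqs l)))

-- Subsequences through at most one of the two exchanged entries are unaffected.
anyᵇ-subseqs-swapHead : (f : List ℕ → Bool) (a b : ℕ) (r : List ℕ) →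
  anyᵇ (λ u → f (b ∷ a ∷ u)) (subseqs r) ≡ anyᵇ (λ u → f (a ∷ b ∷ u)) (subseqs r) →
  anyᵇ f (subseqs (b ∷ a ∷ r)) ≡ anyᵇ f (subseqs (a ∷ b ∷ r))
anyᵇ-subseqs-swapHead f a b r both-swap = begin
  anyᵇ f (subseqs (b ∷ a ∷ r))                                  ≡⟨ expand b a ⟩
  (F (λ u → b ∷ a ∷ u) ∨ F (b ∷_)) ∨ (F (a ∷_) ∨ F id)          ≡⟨ cong (λ t → (t ∨ F (b ∷_)) ∨ (F (a ∷_) ∨ F id)) both-swap ⟩
  (F (λ u → a ∷ b ∷ u) ∨ F (b ∷_)) ∨ (F (a ∷_) ∨ F id)          ≡⟨ ∨-interchange (F (λ u → a ∷ b ∷ u)) (F (b ∷_)) (F (a ∷_)) (F id) ⟩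
  (F (λ u → a ∷ b ∷ u) ∨ F (a ∷_)) ∨ (F (b ∷_) ∨ F id)          ≡⟨ expand a b ⟨
  anyᵇ f (subseqs (a ∷ b ∷ r))                                  ∎
  where
  F : (List ℕ → List ℕ) → Bool
  F g = anyᵇ (f ∘ g) (subseqs r)
  expand : ∀ x y → anyᵇ f (subseqs (x ∷ y ∷ r)) ≡ (F (λ u → x ∷ y ∷ u) ∨ F (x ∷_)) ∨ (F (y ∷_) ∨ F id)
  expand x y = trans (anyᵇ-subseqs-∷ f x (y ∷ r))
                     (cong₂ _∨_ (anyᵇ-subseqs-∷ (f ∘ (x ∷_)) y r) (anyᵇ-subseqs-∷ f y r))

anyᵇ-subseqs-swapLast : (f : List ℕ → Bool) (a b : ℕ) →
  (∀ p → f (p ++ b ∷ a ∷ []) ≡ f (p ++ a ∷ b ∷ [])) →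
  ∀ q → anyᵇ f (subseqs (q ++ b ∷ a ∷ [])) ≡ anyᵇ f (subseqs (q ++ a ∷ b ∷ []))
anyᵇ-subseqs-swapLast f a b last-swap [] =
  anyᵇ-subseqs-swapHead f a b [] (cong (_∨ false) (last-swap []))
anyᵇ-subseqs-swapLast f a b last-swap (x ∷ q) = begin
  anyᵇ f (subseqs (x ∷ q ++ b ∷ a ∷ []))
    ≡⟨ anyᵇ-subseqs-∷ f x (q ++ b ∷ a ∷ []) ⟩
  anyᵇ (f ∘ (x ∷_)) (subseqs (q ++ b ∷ a ∷ [])) ∨ anyᵇ f (subseqs (q ++ b ∷ a ∷ []))
    ≡⟨ cong₂ _∨_ (anyᵇ-subseqs-swapLast (f ∘ (x ∷_)) a b (last-swap ∘ (x ∷_)) q)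
                 (anyᵇ-subseqs-swapLast f a b last-swap q) ⟩
  anyᵇ (f ∘ (x ∷_)) (subseqs (q ++ a ∷ b ∷ [])) ∨ anyᵇ f (subseqs (q ++ a ∷ b ∷ []))
    ≡⟨ anyᵇ-subseqs-∷ f x (q ++ a ∷ b ∷ []) ⟨
  anyᵇ f (subseqs (x ∷ q ++ a ∷ b ∷ [])) ∎

⇔ᵇ-not : (P Q : Bool) → (not P ⇔ᵇ not Q) ≡ (P ⇔ᵇ Q)
⇔ᵇ-not true  true  = refl
⇔ᵇ-not true  false = refl
⇔ᵇ-not false true  = refl
⇔ᵇ-not false false = refl

headAgrees-swap : ∀ c z (p s : List ℕ) {a b x y r w} → length p ≡ length s →
  headAgrees c z (p ++ b ∷ a ∷ r) (s ++ y ∷ x ∷ w) ≡ headAgrees c z (p ++ a ∷ b ∷ r) (s ++ x ∷ y ∷ w)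
headAgrees-swap c z []      []      {a} {b} {x} {y} {r} {w} _ =
  ∧-leftComm ((c >ᵇ b) ⇔ᵇ (z >ᵇ y)) ((c >ᵇ a) ⇔ᵇ (z >ᵇ x)) (headAgrees c z r w)
headAgrees-swap c z (d ∷ p) (e ∷ s) eq = cong (_ ∧_) (headAgrees-swap c z p s (suc-injective eq))

orderIso-swap : ∀ (p s : List ℕ) {a b x y r w} → length p ≡ length s → a ≢ b → x ≢ y →
  orderIso (p ++ b ∷ a ∷ r) (s ++ y ∷ x ∷ w) ≡ orderIso (p ++ a ∷ b ∷ r) (s ++ x ∷ y ∷ w)
orderIso-swap [] [] {a} {b} {x} {y} {r} {w} _ a≢b x≢y = begin
  (((b >ᵇ a) ⇔ᵇ (y >ᵇ x)) ∧ Hb) ∧ (Ha ∧ I)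
    ≡⟨ cong₂ (λ P Q → ((P ⇔ᵇ Q) ∧ Hb) ∧ (Ha ∧ I)) (<ᵇ-flip (≢-sym a≢b)) (<ᵇ-flip (≢-sym x≢y)) ⟩
  ((not (a >ᵇ b) ⇔ᵇ not (x >ᵇ y)) ∧ Hb) ∧ (Ha ∧ I)
    ≡⟨ cong (λ t → (t ∧ Hb) ∧ (Ha ∧ I)) (⇔ᵇ-not (a >ᵇ b) (x >ᵇ y)) ⟩
  (((a >ᵇ b) ⇔ᵇ (x >ᵇ y)) ∧ Hb) ∧ (Ha ∧ I)
    ≡⟨ ∧-interchange ((a >ᵇ b) ⇔ᵇ (x >ᵇ y)) Hb Ha I ⟩
  (((a >ᵇ b) ⇔ᵇ (x >ᵇ y)) ∧ Ha) ∧ (Hb ∧ I) ∎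
  where
  Ha = headAgrees a x r w
  Hb = headAgrees b y r w
  I  = orderIso r w
orderIso-swap (d ∷ p) (e ∷ s) eq a≢b x≢y =
  cong₂ _∧_ (headAgrees-swap d e p s (suc-injective eq)) (orderIso-swap p s (suc-injective eq) a≢b x≢y)

orderIso-length≢ : (u w : List ℕ) → length u ≢ length w → orderIso u w ≡ false
orderIso-length≢ []      []      u≢w = contradiction refl u≢w
orderIso-length≢ []      (_ ∷ _) _   = refl
orderIso-length≢ (_ ∷ _) []      _   = refl
orderIso-length≢ (a ∷ u) (b ∷ w) u≢w =
  trans (cong (headAgrees a b u w ∧_) (orderIso-length≢ u w (u≢w ∘ cong suc))) (∧-zeroʳ _)

matchesPair : List ℕ → List ℕ → List ℕ → Bool
matchesPair σ τ u = orderIso u σ ∨ orderIso u τ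

avoidsAllᵇ-pair : (l σ τ : List ℕ) → avoidsAllᵇ l (σ ∷ τ ∷ []) ≡ not (anyᵇ (matchesPair σ τ) (subseqs l))
avoidsAllᵇ-pair l σ τ = trans (deMorgan (containsᵇ l σ) (containsᵇ l τ))
  (cong not (sym (anyᵇ-∨ (λ u → orderIso u σ) (λ u → orderIso u τ) (subseqs l))))
  where
  deMorgan : (x y : Bool) → not x ∧ (not y ∧ true) ≡ not (x ∨ y)
  deMorgan true  y = refl
  deMorgan false y = ∧-identityʳ (not y)

matchesPair-swap : ∀ (p s : List ℕ) {a b x y r w} → length p ≡ length s → a ≢ b → x ≢ y →
  matchesPair (s ++ x ∷ y ∷ w) (s ++ y ∷ x ∷ w) (p ++ b ∷ a ∷ r) ≡
  matchesPair (s ++ x ∷ y ∷ w) (s ++ y ∷ x ∷ w) (p ++ a ∷ b ∷ r)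
matchesPair-swap p s {a} {b} {x} {y} {r} {w} eq a≢b x≢y =
  trans (cong₂ _∨_ (orderIso-swap p s eq a≢b (≢-sym x≢y)) (orderIso-swap p s eq a≢b x≢y))
        (∨-comm (orderIso (p ++ a ∷ b ∷ r) (s ++ y ∷ x ∷ w)) (orderIso (p ++ a ∷ b ∷ r) (s ++ x ∷ y ∷ w)))

avoidsAllᵇ-swapFront : ∀ {a b x y} (r w : List ℕ) → a ≢ b → x ≢ y →
  avoidsAllᵇ (b ∷ a ∷ r) ((x ∷ y ∷ w) ∷ (y ∷ x ∷ w) ∷ []) ≡ avoidsAllᵇ (a ∷ b ∷ r) ((x ∷ y ∷ w) ∷ (y ∷ x ∷ w) ∷ [])
avoidsAllᵇ-swapFront {a} {b} {x} {y} r w a≢b x≢y = begin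
  avoidsAllᵇ (b ∷ a ∷ r) (σ ∷ τ ∷ [])               ≡⟨ avoidsAllᵇ-pair (b ∷ a ∷ r) σ τ ⟩
  not (anyᵇ (matchesPair σ τ) (subseqs (b ∷ a ∷ r))) ≡⟨ cong not (anyᵇ-subseqs-swapHead (matchesPair σ τ) a b r swap-both) ⟩
  not (anyᵇ (matchesPair σ τ) (subseqs (a ∷ b ∷ r))) ≡⟨ avoidsAllᵇ-pair (a ∷ b ∷ r) σ τ ⟨
  avoidsAllᵇ (a ∷ b ∷ r) (σ ∷ τ ∷ [])               ∎
  where
  σ = x ∷ y ∷ w
  τ = y ∷ x ∷ w
  swap-both : anyᵇ (λ u → matchesPair σ τ (b ∷ a ∷ u)) (subseqs r) ≡ anyᵇ (λ u → matchesPair σ τ (a ∷ b ∷ u)) (subseqs r)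
  swap-both = anyᵇ-cong (λ u → matchesPair-swap [] [] {r = u} {w} refl a≢b x≢y) (subseqs r)

-- A prefix of the wrong length never extends to an occurrence, whatever the order of the last two entries.
avoidsAllᵇ-swapLast : ∀ (q s : List ℕ) {a b x y} → a ≢ b → x ≢ y →
  avoidsAllᵇ (q ++ b ∷ a ∷ []) ((s ++ x ∷ y ∷ []) ∷ (s ++ y ∷ x ∷ []) ∷ []) ≡
  avoidsAllᵇ (q ++ a ∷ b ∷ []) ((s ++ x ∷ y ∷ []) ∷ (s ++ y ∷ x ∷ []) ∷ [])
avoidsAllᵇ-swapLast q s {a} {b} {x} {y} a≢b x≢y = begin
  avoidsAllᵇ (q ++ b ∷ a ∷ []) (σ ∷ τ ∷ [])               ≡⟨ avoidsAllᵇ-pair (q ++ b ∷ a ∷ []) σ τ ⟩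
  not (anyᵇ (matchesPair σ τ) (subseqs (q ++ b ∷ a ∷ []))) ≡⟨ cong not (anyᵇ-subseqs-swapLast (matchesPair σ τ) a b last-swap q) ⟩
  not (anyᵇ (matchesPair σ τ) (subseqs (q ++ a ∷ b ∷ []))) ≡⟨ avoidsAllᵇ-pair (q ++ a ∷ b ∷ []) σ τ ⟨
  avoidsAllᵇ (q ++ a ∷ b ∷ []) (σ ∷ τ ∷ [])               ∎
  where
  σ = s ++ x ∷ y ∷ []
  τ = s ++ y ∷ x ∷ []
  mismatch : ∀ p {c d} → length p ≢ length s → matchesPair σ τ (p ++ c ∷ d ∷ []) ≡ false
  mismatch p {c} {d} p≢s = cong₂ _∨_ (orderIso-length≢ (p ++ c ∷ d ∷ []) σ length≢) (orderIso-length≢ (p ++ c ∷ d ∷ []) τ length≢)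
    where
    length≢ : ∀ {c d e f} → length (p ++ c ∷ d ∷ []) ≢ length (s ++ e ∷ f ∷ [])
    length≢ eq = p≢s (+-cancelʳ-≡ 2 _ _ (trans (sym (length-++ p)) (trans eq (length-++ s))))
  last-swap : ∀ p → matchesPair σ τ (p ++ b ∷ a ∷ []) ≡ matchesPair σ τ (p ++ a ∷ b ∷ [])
  last-swap p with length p ≟ length s
  ... | yes p≡s = matchesPair-swap p s p≡s a≢b x≢y
  ... | no  p≢s = trans (mismatch p p≢s) (sym (mismatch p p≢s))

data LastTwoSwapped : List ℕ → List ℕ → Set where
  swapped : ∀ q a b → LastTwoSwapped (q ++ a ∷ b ∷ []) (q ++ b ∷ a ∷ [])

toℕs : ∀ {n k} → Vec (Fin n) k → List ℕ
toℕs v = map toℕ (toList v)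

toℕs-swapBack : ∀ {n k} (v : Vec (Fin n) (2 + k)) → LastTwoSwapped (toℕs v) (toℕs (swapBack v))
toℕs-swapBack {k = zero}  (i ∷ j ∷ []) = swapped [] (toℕ i) (toℕ j)
toℕs-swapBack {k = suc k} (i ∷ v)      = prepend (toℕs-swapBack v)
  where
  prepend : ∀ {l l′} → LastTwoSwapped l l′ → LastTwoSwapped (toℕ i ∷ l) (toℕ i ∷ l′)
  prepend (swapped q a b) = swapped (toℕ i ∷ q) a b

signBalanced-swapFront : ∀ k {x y} (w : List ℕ) → x ≢ y →
  SignBalanced (Av (2 + k) ((x ∷ y ∷ w) ∷ (y ∷ x ∷ w) ∷ []))
signBalanced-swapFront k {x} {y} w x≢y =
  signBalanced-bySignReversal σs swapFront (count-allVecs-swapFront _ k) reverses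
  where
  σs = (x ∷ y ∷ w) ∷ (y ∷ x ∷ w) ∷ []
  reverses : ∀ v → SignReversal σs (oneLine v) (oneLine (swapFront v))
  reverses (i ∷ j ∷ v) = adjacentSwap-reverses σs [] (toℕ i) (toℕ j) (toℕs v)
                           (λ i≢j → avoidsAllᵇ-swapFront (toℕs v) w i≢j x≢y)

signBalanced-swapBack : ∀ k {x y} (s : List ℕ) → x ≢ y →
  SignBalanced (Av (2 + k) ((s ++ x ∷ y ∷ []) ∷ (s ++ y ∷ x ∷ []) ∷ []))
signBalanced-swapBack k {x} {y} s x≢y =
  signBalanced-bySignReversal σs swapBack (count-allVecs-swapBack _ k) (reverses ∘ toℕs-swapBack)
  where
  σs = (s ++ x ∷ y ∷ []) ∷ (s ++ y ∷ x ∷ []) ∷ []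
  reverses : ∀ {l l′} → LastTwoSwapped l l′ → SignReversal σs l l′
  reverses (swapped q a b) = adjacentSwap-reverses σs q a b [] (λ a≢b → avoidsAllᵇ-swapLast q s a≢b x≢y)

proposition3p2 : ∀ (n : ℕ) → 1 < n →
    SignBalanced (Av n ((1 ∷ 2 ∷ 3 ∷ []) ∷ (2 ∷ 1 ∷ 3 ∷ []) ∷ []))
    × SignBalanced (Av n ((3 ∷ 2 ∷ 1 ∷ []) ∷ (2 ∷ 3 ∷ 1 ∷ []) ∷ []))
    × SignBalanced (Av n ((1 ∷ 2 ∷ 3 ∷ []) ∷ (1 ∷ 3 ∷ 2 ∷ []) ∷ []))
    × SignBalanced (Av n ((3 ∷ 2 ∷ 1 ∷ []) ∷ (3 ∷ 1 ∷ 2 ∷ []) ∷ []))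
proposition3p2 (suc zero)    (s≤s ())
proposition3p2 (suc (suc k)) _ =
  signBalanced-swapFront k (3 ∷ []) (λ ()) ,
  signBalanced-swapFront k (1 ∷ []) (λ ()) ,
  signBalanced-swapBack  k (1 ∷ []) (λ ()) ,
  signBalanced-swapBack  k (3 ∷ []) (λ ())
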